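{- Let $\mathcal{F}$ be a signature partitioned into defined symbols $\mathcal{D}$ and constructors $\mathcal{C}$, let $\succsim$ be an admissible quasi-precedence on $\mathcal{F}$ and $\mathsf{safe}$ a safe mapping on $\mathcal{F}$, and let $>_{\mathsf{epo}^*}$ be the induced exponential path order. Let $\mathcal{R}$ be a finite constructor TRS over $\mathcal{F}$ that is compatible with $>_{\mathsf{epo}^*}$, i.e. $l >_{\mathsf{epo}^*} r$ for every rule $l \to r \in \mathcal{R}$. Then there is a fixed $k \in \mathbb{N}$ such that the innermost runtime complexity satisfies $\mathrm{rc}^{\mathsf{i}}_{\mathcal{R}}(n) \le 2^{O(n^k)}$.
   Context: $\mathcal{V}$ is a countably infinite set of variables and $\mathcal{T}(\mathcal{F},\mathcal{V})$ the set of terms; $|t|$ is the number of symbols of $t$. A quasi-precedence $\succsim$ is a preorder on $\mathcal{F}$ whose strict part $\succ$ is well-founded; $\sim$ denotes its equivalence part. It is admissible if $f \succ c$ for every $f\in\mathcal{D}$ and every $c\in\mathcal{C}$. A safe mapping assigns to each $n$-ary $f$ a set $\mathsf{safe}(f)\subseteq\{1,\dots,n\}$ of safe argument positions (the remaining positions are normal); for constructors all positions are safe. We write $f(s_1,\dots,s_l;s_{l+1},\dots,s_{l+m})$ for a term whose normal arguments (in order of position) are $s_1,\dots,s_l$ and whose safe arguments (in order of position) are $s_{l+1},\dots,s_{l+m}$. Relation $\approx_s$: $s\approx_s t$ iff $s=t$, or $s=f(s_1,\dots,s_l;s_{l+1},\dots,s_{l+m})$, $t=g(t_1,\dots,t_l;t_{l+1},\dots,t_{l+m})$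 (same $l,m$), $f\sim g$ and $s_i\approx_s t_i$ for all $i$. Relation $\rhd_*$ (least such): $f(s_1,\dots,s_n)\rhd_* t$ iff for some argument position $i$ we have $s_i \rhd_* t$ or $s_i\approx_s t$, where $i$ must be a normal position of $f$ whenever $f\in\mathcal{D}$. The exponential path order $>_{\mathsf{epo}^*}$ is the least relation such that for $s=f(s_1,\dots,s_l;s_{l+1},\dots,s_{l+m})$, $s>_{\mathsf{epo}^*}t$ if (1) $s_i \geq_{\mathsf{epo}^*} t$ for some $i\in\{1,\dots,l+m\}$; or (2) $t=g(t_1,\dots,t_k;t_{k+1},\dots,t_{k+n})$, $f\succ g$, $s\rhd_* t_j$ for all $j\le k$ and $s>_{\mathsf{epo}^*}t_j$ for all $k<j\le k+n$; or (3) $t=g(t_1,\dots,t_k;t_{k+1},\dots,t_{k+n})$, $f\sim g$, and for some $i\in\{1,\dots,\min(l,k)\}$: $s_1\approx_s t_1,\dots,s_{i-1}\approx_s t_{i-1}$, $s_i\rhd_* t_i$, $s\rhd_* t_j$ for all $i<j\le k$, and $s>_{\mathsf{epo}^*}t_j$ for all $k<j\le k+n$. Here ${\geq_{\mathsf{epo}^*}} = {>_{\mathsf{epo}^*}}\cup{\approx_s}$. A TRS is a set of rules $l\to r$ with $l\notin\mathcal{V}$ and all variables of $r$ occurring in $l$. Innermost rewriting: $s\to_{\mathsf{i}} t$ iff $s=C[l\sigma]$, $t=C[r\sigma]$ for a context $C$, substitution $\sigma$, rule $l\to r$, where all proper subterms of $l\sigma$ are normal forms. Basic terms are $f(t_1,\dots,t_n)$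 with $f\in\mathcal{D}$, $t_i\in\mathcal{T}(\mathcal{C},\mathcal{V})$. A TRS is a constructor TRS if all left-hand sides are basic. $\mathrm{dl}(t,\to)=\max\{n\mid \exists u.\ t\to^n u\}$ and $\mathrm{rc}^{\mathsf{i}}_{\mathcal{R}}(n)=\max\{\mathrm{dl}(t,\to_{\mathsf{i}})\mid t \text{ basic}, |t|\le n\}$. -}

module Defs where

open import Level using (0ℓ)
open import Data.Nat using (ℕ; zero; suc; _+_; _*_; _^_; _≤_)
open import Data.Bool using (Bool; true; false; not; if_then_else_)
open import Data.Fin using (Fin; zero; suc)
open import Data.Vec using (Vec; []; _∷_; lookup; _[_]≔_)
open import Data.List using (List; []; _∷_; _++_)
open import Data.List.Membership.Propositional using (_∈_)
open import Data.List.Relation.Unary.All using (All)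
open import Data.List.Relation.Binary.Pointwise using (Pointwise)
import Data.Vec.Relation.Unary.All as VAll
open import Data.Product using (Σ; ∃; _×_; _,_)
open import Data.Sum using (_⊎_)
open import Relation.Nullary using (¬_)
open import Relation.Binary using (Rel; IsPreorder)
open import Relation.Binary.PropositionalEquality using (_≡_)
open import Induction.WellFounded using (WellFounded)

-- Signature: finitely many function symbols Fin N, with arity `ar`;
-- `isDef f ≡ true` means f ∈ 𝒟, `isDef f ≡ false` means f ∈ 𝒞.
-- Variables are ℕ (countably infinite).
module Theory (N : ℕ) (ar : Fin N → ℕ) (isDef : Fin N → Bool) where

  data Term : Set where
    var : ℕ → Term
    fun : (f : Fin N) → Vec Term (ar f) → Term

  mutual
    size : Term → ℕ
    size (var x)    = 1
    size (fun f ts) = suc (sizes ts)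

    sizes : ∀ {n} → Vec Term n → ℕ
    sizes []       = 0
    sizes (t ∷ ts) = size t + sizes ts

  Subst : Set
  Subst = ℕ → Term

  mutual
    _⟪_⟫ : Term → Subst → Term
    var x    ⟪ σ ⟫ = σ x
    fun f ts ⟪ σ ⟫ = fun f (substs ts σ)

    substs : ∀ {n} → Vec Term n → Subst → Vec Term n
    substs []       σ = []
    substs (t ∷ ts) σ = (t ⟪ σ ⟫) ∷ substs ts σ

  data _∈V_ (x : ℕ) : Term → Set where
    here : x ∈V var x
    arg  : ∀ {f ts} (i : Fin (ar f)) → x ∈V lookup ts i → x ∈V fun f ts

  data _◁_ (u : Term) : Term → Set where
    direct : ∀ {f ts} (i : Fin (ar f)) → u ≡ lookup ts i → u ◁ fun f ts
    deeper : ∀ {f ts} (i : Fin (ar f)) → u ◁ lookup ts i → u ◁ fun f ts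

  record Rule : Set where
    constructor _⟶_⟨_,_⟩
    field
      lhs : Term
      rhs : Term
      lhs-nonvar : ∀ x → ¬ (lhs ≡ var x)
      var-cond   : ∀ x → x ∈V rhs → x ∈V lhs
  open Rule public

  TRS : Set
  TRS = List Rule

  data ConTerm : Term → Set where
    var : ∀ x → ConTerm (var x)
    fun : ∀ {c ts} → isDef c ≡ false → VAll.All ConTerm ts → ConTerm (fun c ts)

  data Basic : Term → Set where
    basic : ∀ {f ts} → isDef f ≡ true → VAll.All ConTerm ts → Basic (fun f ts)

  ConstructorTRS : TRS → Set
  ConstructorTRS R = ∀ {ρ} → ρ ∈ R → Basic (lhs ρ)

  data _⊢_⟶_ (R : TRS) : Term → Term → Set where
    root : ∀ {ρ} (σ : Subst) → ρ ∈ R → R ⊢ (lhs ρ ⟪ σ ⟫) ⟶ (rhs ρ ⟪ σ ⟫)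
    cong : ∀ {f ts u} (i : Fin (ar f)) → R ⊢ lookup ts i ⟶ u →
           R ⊢ fun f ts ⟶ fun f (ts [ i ]≔ u)

  NF : TRS → Term → Set
  NF R t = ∀ u → ¬ (R ⊢ t ⟶ u)

  data _⊢_⟶ᵢ_ (R : TRS) : Term → Term → Set where
    root : ∀ {ρ} (σ : Subst) → ρ ∈ R →
           (∀ u → u ◁ (lhs ρ ⟪ σ ⟫) → NF R u) →
           R ⊢ (lhs ρ ⟪ σ ⟫) ⟶ᵢ (rhs ρ ⟪ σ ⟫)
    cong : ∀ {f ts u} (i : Fin (ar f)) → R ⊢ lookup ts i ⟶ᵢ u →
           R ⊢ fun f ts ⟶ᵢ fun f (ts [ i ]≔ u)

  data _⊢_⟶ᵢ[_]_ (R : TRS) : Term → ℕ → Term → Set where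
    done : ∀ {t} → R ⊢ t ⟶ᵢ[ 0 ] t
    step : ∀ {t u v n} → R ⊢ t ⟶ᵢ u → R ⊢ u ⟶ᵢ[ n ] v → R ⊢ t ⟶ᵢ[ suc n ] v

  module Order (_≿_ : Rel (Fin N) 0ℓ) (safe : (f : Fin N) → Fin (ar f) → Bool) where

    _≻_ : Rel (Fin N) 0ℓ
    f ≻ g = f ≿ g × ¬ (g ≿ f)

    _≺_ : Rel (Fin N) 0ℓ
    g ≺ f = f ≻ g

    _∼_ : Rel (Fin N) 0ℓ
    f ∼ g = f ≿ g × g ≿ f

    IsQuasiPrecedence : Set
    IsQuasiPrecedence = IsPreorder _≡_ _≿_ × WellFounded _≺_

    Admissible : Set
    Admissible = ∀ f c → isDef f ≡ true → isDef c ≡ false → f ≻ c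

    SafeMapping : Set
    SafeMapping = ∀ c (i : Fin (ar c)) → isDef c ≡ false → safe c i ≡ true

    select : ∀ {A : Set} {n} → (Fin n → Bool) → Vec A n → List A
    select p []       = []
    select p (x ∷ xs) with p zero
    ... | true  = x ∷ select (λ i → p (suc i)) xs
    ... | false = select (λ i → p (suc i)) xs

    normArgs : (f : Fin N) → Vec Term (ar f) → List Term
    normArgs f ts = select (λ i → not (safe f i)) ts

    safeArgs : (f : Fin N) → Vec Term (ar f) → List Term
    safeArgs f ts = select (safe f) ts

    data _≈s_ : Term → Term → Set where
      ≈-refl : ∀ {t} → t ≈s t
      ≈-fun  : ∀ {f g ss ts} → f ∼ g →
               Pointwise _≈s_ (normArgs f ss) (normArgs g ts) →
               Pointwise _≈s_ (safeArgs f ss) (safeArgs g ts) →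
               fun f ss ≈s fun g ts

    data _▷*_ : Term → Term → Set where
      sub : ∀ {f ss t} (i : Fin (ar f)) →
            (isDef f ≡ true → safe f i ≡ false) →
            (lookup ss i ▷* t ⊎ lookup ss i ≈s t) →
            fun f ss ▷* t

    data _>epo_ : Term → Term → Set where
      epo1 : ∀ {f ss t} (i : Fin (ar f)) →
             (lookup ss i >epo t ⊎ lookup ss i ≈s t) →
             fun f ss >epo t
      epo2 : ∀ {f ss g ts} → f ≻ g →
             All (fun f ss ▷*_) (normArgs g ts) →
             All (fun f ss >epo_) (safeArgs g ts) →
             fun f ss >epo fun g ts
      epo3 : ∀ {f ss g ts} → f ∼ g →
             (ps rs qs rt : List Term) (a b : Term) →
             normArgs f ss ≡ ps ++ (a ∷ rs) →
             normArgs g ts ≡ qs ++ (b ∷ rt) →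
             Pointwise _≈s_ ps qs →
             a ▷* b →
             All (fun f ss ▷*_) rt →
             All (fun f ss >epo_) (safeArgs g ts) →
             fun f ss >epo fun g ts

    Compatible : TRS → Set
    Compatible R = ∀ {ρ} → ρ ∈ R → lhs ρ >epo rhs ρ

-- Innermost, a call f(ts) is rewritten at the root only once all its arguments are normal, and by
-- the definition of >epo* the normal arguments of the calls in a right-hand side are constructor
-- subterms of the normal arguments of the left-hand side. So in a derivation from a basic term of size
-- n every call has normal arguments of size at most n. Measure a call by the rank of its root in the
-- precedence and then lexicographically by the sizes of its normal arguments: >epo* makes this
-- measure drop from a call to every call of the right-hand side rewriting it, and it takes at most
-- (N + 1)(n + 1)^A values, A the maximal arity. As a right-hand side has at most K symbols, each a call
-- of smaller measure, a call of measure j has derivation length at most (K + 1)^j, which is 2^O(n^A).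

module Submission where

open import Defs
open import Level using (0ℓ)
open import Data.Nat using (ℕ; _+_; _*_; _^_; _≤_)
open import Data.Bool using (Bool)
open import Data.Fin using (Fin)
open import Data.Product using (∃; _×_)
open import Relation.Binary using (Rel)

open import Data.Nat using (zero; suc; _<_; z≤n; s≤s; s≤s⁻¹; NonZero)
open import Data.Nat.Properties
open import Data.Nat.ListAction using () renaming (sum to sumˡ)
open import Data.Nat.Solver using (module +-*-Solver)
open import Data.Bool using (true; false; not)
open import Data.Empty using (⊥; ⊥-elim)
open import Data.Fin as Fin using (zero; suc)
open import Data.Fin.Properties using (injective⇒≤; ¬Fin0)
open import Data.List as List using (List; []; _∷_; _++_; length)
open import Data.List.Extrema.Nat using (max; xs≤max)
open import Data.List.Membership.Propositional using (_∈_)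
open import Data.List.Membership.Propositional.Properties using (∈-map⁺; ∈-allFin)
open import Data.List.Properties using (map-++; length-map; map-∘; ++-conicalʳ)
open import Data.List.Relation.Binary.Pointwise using (Pointwise; []; _∷_)
open import Data.List.Relation.Unary.All as All using (All; []; _∷_)
open import Data.List.Relation.Unary.All.Properties using (++⁺; ++⁻; map⁺)
open import Data.Product using (∃₂; _,_; proj₁; proj₂)
open import Data.Sum using (_⊎_; inj₁; inj₂)
open import Data.Vec as Vec using (Vec; []; _∷_; lookup; _[_]≔_)
open import Data.Vec.Functional using (Vector; head; tail; updateAt)
open import Data.Vec.Functional.Properties using (updateAt-updates; updateAt-minimal)
open import Data.Vec.Properties using (lookup∘update; lookup∘update′)
import Data.Vec.Relation.Unary.All as VAll
open import Data.Vec.Relation.Unary.All.Properties using (lookup⁺; lookup⁻)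
open import Function using (_∘_; const)
open import Function.Definitions using (Injective)
open import Relation.Binary using (IsPreorder)
open import Relation.Binary.PropositionalEquality as ≡
  using (_≡_; _≢_; refl; sym; trans; subst; subst₂; cong₂; module ≡-Reasoning)
open import Relation.Nullary using (¬_; yes; no; contradiction)

open import Algebra.Properties.CommutativeSemigroup +-commutativeSemigroup using (x∙yz≈y∙xz)
open import Algebra.Properties.Monoid.Sum +-0-monoid using (sum)
open +-*-Solver using (solve; _:+_; _:*_; _:=_; con)

-- Leading digits xs, padded with zeros (or truncated) to d digits.
numeral : (b d : ℕ) → List ℕ → ℕ
numeral b d       []       = 0
numeral b zero    (x ∷ xs) = 0
numeral b (suc d) (x ∷ xs) = x * b ^ d + numeral b d xs

numeral< : ∀ b .{{_ : NonZero b}} d xs → All (_< b) xs → length xs ≤ d → numeral b d xs < b ^ d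
numeral< b d       []       _          _         = m^n>0 b d
numeral< b (suc d) (x ∷ xs) (x<b ∷ xs<b) (s≤s len≤d) = begin-strict
  x * b ^ d + numeral b d xs  <⟨ +-monoʳ-< (x * b ^ d) (numeral< b d xs xs<b len≤d) ⟩
  x * b ^ d + b ^ d           ≡⟨ +-comm (x * b ^ d) (b ^ d) ⟩
  suc x * b ^ d               ≤⟨ *-monoˡ-≤ (b ^ d) x<b ⟩
  b * b ^ d                   ∎
  where open ≤-Reasoning

numeral-lex-< : ∀ b .{{_ : NonZero b}} d xs ys {x y} zs → y < x → All (_< b) zs →
                length (xs ++ y ∷ zs) ≤ d → numeral b d (xs ++ y ∷ zs) < numeral b d (xs ++ x ∷ ys)
numeral-lex-< b (suc d) [] ys {x} {y} zs y<x zs<b (s≤s len≤d) = begin-strict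
  y * b ^ d + numeral b d zs  <⟨ +-monoʳ-< (y * b ^ d) (numeral< b d zs zs<b len≤d) ⟩
  y * b ^ d + b ^ d           ≡⟨ +-comm (y * b ^ d) (b ^ d) ⟩
  suc y * b ^ d               ≤⟨ *-monoˡ-≤ (b ^ d) y<x ⟩
  x * b ^ d                   ≤⟨ m≤m+n (x * b ^ d) (numeral b d ys) ⟩
  x * b ^ d + numeral b d ys  ∎
  where open ≤-Reasoning
numeral-lex-< b (suc d) (w ∷ xs) ys zs y<x zs<b (s≤s len≤d) =
  +-monoʳ-< (w * b ^ d) (numeral-lex-< b d xs ys zs y<x zs<b len≤d)

sum-updateAt-pred : ∀ {n} (xs : Vector ℕ n) i {v} → xs i ≡ suc v →
                    sum xs ≡ suc (sum (updateAt xs i (const v)))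
sum-updateAt-pred xs zero    xs₀≡1+v = ≡.cong (_+ sum (tail xs)) xs₀≡1+v
sum-updateAt-pred xs (suc i) xsᵢ≡1+v =
  trans (≡.cong (head xs +_) (sum-updateAt-pred (tail xs) i xsᵢ≡1+v)) (+-suc (head xs) _)

≤-max-map : ∀ {A : Set} (f : A → ℕ) {x xs} → x ∈ xs → f x ≤ max 0 (List.map f xs)
≤-max-map f {xs = xs} x∈xs = All.lookup (xs≤max 0 (List.map f xs)) (∈-map⁺ f x∈xs)

1+n≤2^n : ∀ n → suc n ≤ 2 ^ n
1+n≤2^n zero    = ≤-refl
1+n≤2^n (suc n) = +-mono-≤ (m^n>0 2 n) (≤-trans (1+n≤2^n n) (m≤m+n (2 ^ n) 0))

[1+n]^k≤2^k*n^k : ∀ n k → 1 ≤ n → suc n ^ k ≤ 2 ^ k * n ^ k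
[1+n]^k≤2^k*n^k n zero    _   = ≤-refl
[1+n]^k≤2^k*n^k n (suc k) 1≤n = begin
  suc n * suc n ^ k            ≤⟨ *-mono-≤ (+-monoˡ-≤ n 1≤n) ([1+n]^k≤2^k*n^k n k 1≤n) ⟩
  (n + n) * (2 ^ k * n ^ k)    ≡⟨ solve 3 (λ n x y → (n :+ n) :* (x :* y) := (con 2 :* x) :* (n :* y))
                                        refl n (2 ^ k) (n ^ k) ⟩
  2 * 2 ^ k * (n * n ^ k)      ∎
  where open ≤-Reasoning

exponential-bound : ∀ K N A n → 1 ≤ n →
  suc K ^ (suc N * suc n ^ A) ≤ 2 ^ (K * suc N * 2 ^ A * n ^ A + K * suc N * 2 ^ A)
exponential-bound K N A n 1≤n = begin
  suc K ^ (suc N * suc n ^ A)       ≤⟨ ^-monoˡ-≤ (suc N * suc n ^ A) (1+n≤2^n K) ⟩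
  (2 ^ K) ^ (suc N * suc n ^ A)     ≡⟨ ^-*-assoc 2 K _ ⟩
  2 ^ (K * (suc N * suc n ^ A))     ≤⟨ ^-monoʳ-≤ 2 (≤-trans exponent≤ (m≤m+n _ _)) ⟩
  2 ^ (C * n ^ A + C)               ∎
  where
  open ≤-Reasoning
  C = K * suc N * 2 ^ A
  exponent≤ : K * (suc N * suc n ^ A) ≤ C * n ^ A
  exponent≤ = ≤-trans (*-monoʳ-≤ K (*-monoʳ-≤ (suc N) ([1+n]^k≤2^k*n^k n A 1≤n)))
                (≤-reflexive (solve 4 (λ k s x y → k :* (s :* (x :* y)) := (k :* s :* x) :* y)
                                refl K (suc N) (2 ^ A) (n ^ A)))

module _ (N : ℕ) (ar : Fin N → ℕ) (isDef : Fin N → Bool) where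
  open Theory N ar isDef

  lookup-substs : ∀ {n} (ts : Vec Term n) σ i → lookup (substs ts σ) i ≡ lookup ts i ⟪ σ ⟫
  lookup-substs (t ∷ ts) σ zero    = refl
  lookup-substs (t ∷ ts) σ (suc i) = lookup-substs ts σ i

  substs≡map : ∀ {n} (ts : Vec Term n) σ → substs ts σ ≡ Vec.map (_⟪ σ ⟫) ts
  substs≡map []       σ = refl
  substs≡map (t ∷ ts) σ = ≡.cong (t ⟪ σ ⟫ ∷_) (substs≡map ts σ)

  mutual
    ⟪var⟫-identity : ∀ t → t ⟪ var ⟫ ≡ t
    ⟪var⟫-identity (var x)    = refl
    ⟪var⟫-identity (fun f ts) = ≡.cong (fun f) (substs-var-identity ts)

    substs-var-identity : ∀ {n} (ts : Vec Term n) → substs ts var ≡ ts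
    substs-var-identity []       = refl
    substs-var-identity (t ∷ ts) = cong₂ _∷_ (⟪var⟫-identity t) (substs-var-identity ts)

  0<size : ∀ t → 0 < size t
  0<size (var x)    = s≤s z≤n
  0<size (fun f ts) = s≤s z≤n

  size-lookup≤sizes : ∀ {n} (ts : Vec Term n) i → size (lookup ts i) ≤ sizes ts
  size-lookup≤sizes (t ∷ ts) zero    = m≤m+n (size t) (sizes ts)
  size-lookup≤sizes (t ∷ ts) (suc i) = ≤-trans (size-lookup≤sizes ts i) (m≤n+m (sizes ts) (size t))

  sum-size*≡sizes* : ∀ {n} (ts : Vec Term n) q → sum (λ i → size (lookup ts i) * q) ≡ sizes ts * q
  sum-size*≡sizes* []       q = refl
  sum-size*≡sizes* (t ∷ ts) q =
    trans (≡.cong (size t * q +_) (sum-size*≡sizes* ts q)) (sym (*-distribʳ-+ q (size t) (sizes ts)))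

  ∈V-⟪⟫ : ∀ {x} t σ → x ∈V t → t ≡ var x ⊎ σ x ◁ (t ⟪ σ ⟫)
  ∈V-⟪⟫ t          σ here      = inj₁ refl
  ∈V-⟪⟫ (fun f ts) σ (arg i p) with ∈V-⟪⟫ (lookup ts i) σ p
  ... | inj₁ tᵢ≡x  = inj₂ (direct i (sym (trans (lookup-substs ts σ i) (≡.cong (_⟪ σ ⟫) tᵢ≡x))))
  ... | inj₂ σx◁tᵢ = inj₂ (deeper i (subst (_ ◁_) (sym (lookup-substs ts σ i)) σx◁tᵢ))

  module _ (_≿_ : Rel (Fin N) 0ℓ) (safe : (f : Fin N) → Fin (ar f) → Bool) where
    open Order _≿_ safe

    module _ {A : Set} {P : A → Set} where
      All-select⁻ : ∀ {n} (p : Fin n → Bool) (xs : Vec A n) →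
                    All P (select p xs) → ∀ i → p i ≡ true → P (lookup xs i)
      All-select⁻ p (x ∷ xs) all zero pᵢ with p zero
      All-select⁻ p (x ∷ xs) (px ∷ _) zero refl | true = px
      All-select⁻ p (x ∷ xs) all      zero ()   | false
      All-select⁻ p (x ∷ xs) all (suc i) pᵢ with p zero
      ... | true  = All-select⁻ (p ∘ suc) xs (All.tail all) i pᵢ
      ... | false = All-select⁻ (p ∘ suc) xs all i pᵢ

      All-select⁺ : ∀ {n} (p : Fin n → Bool) (xs : Vec A n) →
                    (∀ i → p i ≡ true → P (lookup xs i)) → All P (select p xs)
      All-select⁺ p []       h = []
      All-select⁺ p (x ∷ xs) h with p zero in p₀
      ... | true  = h zero p₀ ∷ All-select⁺ (p ∘ suc) xs (h ∘ suc)
      ... | false = All-select⁺ (p ∘ suc) xs (h ∘ suc)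

    module _ {A : Set} where
      select-cong : ∀ {n} (p : Fin n → Bool) (xs ys : Vec A n) →
                    (∀ i → p i ≡ true → lookup xs i ≡ lookup ys i) → select p xs ≡ select p ys
      select-cong p []       []       h = refl
      select-cong p (x ∷ xs) (y ∷ ys) h with p zero in p₀
      ... | true  = cong₂ _∷_ (h zero p₀) (select-cong (p ∘ suc) xs ys (h ∘ suc))
      ... | false = select-cong (p ∘ suc) xs ys (h ∘ suc)

      select-map : ∀ {B : Set} {n} (g : A → B) (p : Fin n → Bool) (xs : Vec A n) →
                   select p (Vec.map g xs) ≡ List.map g (select p xs)
      select-map g p []       = refl
      select-map g p (x ∷ xs) with p zero
      ... | true  = ≡.cong (g x ∷_) (select-map g (p ∘ suc) xs)
      ... | false = select-map g (p ∘ suc) xs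

      length-select≤ : ∀ {n} (p : Fin n → Bool) (xs : Vec A n) → length (select p xs) ≤ n
      length-select≤ p []       = z≤n
      length-select≤ p (x ∷ xs) with p zero
      ... | true  = s≤s (length-select≤ (p ∘ suc) xs)
      ... | false = m≤n⇒m≤1+n (length-select≤ (p ∘ suc) xs)

      select-none : ∀ {n} (p : Fin n → Bool) (xs : Vec A n) → (∀ i → p i ≡ false) → select p xs ≡ []
      select-none p []       h = refl
      select-none p (x ∷ xs) h with p zero | h zero
      ... | false | _ = select-none (p ∘ suc) xs (h ∘ suc)

    not≡true : ∀ {b} → not b ≡ true → b ≡ false
    not≡true {false} _ = refl

    SameNormalArgs : (f : Fin N) → Vec Term (ar f) → Vec Term (ar f) → Set
    SameNormalArgs f ts us = ∀ i → safe f i ≡ false → lookup ts i ≡ lookup us i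

    size⟪_⟫ : Subst → Term → ℕ
    size⟪ σ ⟫ t = size (t ⟪ σ ⟫)

    select-substs : ∀ {n} (p : Fin n → Bool) (ts : Vec Term n) σ →
                    select p (substs ts σ) ≡ List.map (_⟪ σ ⟫) (select p ts)
    select-substs p ts σ = trans (≡.cong (select p) (substs≡map ts σ)) (select-map (_⟪ σ ⟫) p ts)

    sizes-substs-split : ∀ {n} (p : Fin n → Bool) (ts : Vec Term n) σ →
      sizes (substs ts σ) ≡ sumˡ (List.map size⟪ σ ⟫ (select (not ∘ p) ts))
                            + sumˡ (List.map size⟪ σ ⟫ (select p ts))
    sizes-substs-split p []       σ = refl
    sizes-substs-split p (t ∷ ts) σ with p zero
    ... | true  = trans (≡.cong (size⟪ σ ⟫ t +_) (sizes-substs-split (p ∘ suc) ts σ))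
                        (x∙yz≈y∙xz (size⟪ σ ⟫ t)
                          (sumˡ (List.map size⟪ σ ⟫ (select (not ∘ p ∘ suc) ts)))
                          (sumˡ (List.map size⟪ σ ⟫ (select (p ∘ suc) ts))))
    ... | false = trans (≡.cong (size⟪ σ ⟫ t +_) (sizes-substs-split (p ∘ suc) ts σ))
                        (sym (+-assoc (size⟪ σ ⟫ t) _ _))

    mutual
      ≈s-size : ∀ {s t} σ → s ≈s t → size⟪ σ ⟫ s ≡ size⟪ σ ⟫ t
      ≈s-size σ ≈-refl = refl
      ≈s-size σ (≈-fun {f} {g} {ss} {ts} _ normal≈ safe≈) = ≡.cong suc (begin
        sizes (substs ss σ)                                           ≡⟨ sizes-substs-split (safe f) ss σ ⟩
        sumˡ (List.map size⟪ σ ⟫ (normArgs f ss)) + sumˡ (List.map size⟪ σ ⟫ (safeArgs f ss))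
          ≡⟨ cong₂ _+_ (≡.cong sumˡ (≈s-sizes σ normal≈)) (≡.cong sumˡ (≈s-sizes σ safe≈)) ⟩
        sumˡ (List.map size⟪ σ ⟫ (normArgs g ts)) + sumˡ (List.map size⟪ σ ⟫ (safeArgs g ts))
          ≡⟨ sizes-substs-split (safe g) ts σ ⟨
        sizes (substs ts σ)                                           ∎)
        where open ≡-Reasoning

      ≈s-sizes : ∀ {xs ys} σ → Pointwise _≈s_ xs ys → List.map size⟪ σ ⟫ xs ≡ List.map size⟪ σ ⟫ ys
      ≈s-sizes σ []         = refl
      ≈s-sizes σ (x≈y ∷ xs≈ys) = cong₂ _∷_ (≈s-size σ x≈y) (≈s-sizes σ xs≈ys)

    size⟪⟫-lookup< : ∀ {f} (ss : Vec Term (ar f)) σ i → size⟪ σ ⟫ (lookup ss i) < size⟪ σ ⟫ (fun f ss)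
    size⟪⟫-lookup< ss σ i =
      s≤s (subst (_≤ sizes (substs ss σ)) (≡.cong size (lookup-substs ss σ i))
                 (size-lookup≤sizes (substs ss σ) i))

    ▷*-size< : ∀ {s t} σ → s ▷* t → size⟪ σ ⟫ t < size⟪ σ ⟫ s
    ▷*-size< σ (sub {ss = ss} i _ (inj₁ sᵢ▷t)) = <-trans (▷*-size< σ sᵢ▷t) (size⟪⟫-lookup< ss σ i)
    ▷*-size< σ (sub {ss = ss} i _ (inj₂ sᵢ≈t)) = subst (_< _) (≈s-size σ sᵢ≈t) (size⟪⟫-lookup< ss σ i)

    ▷*-normal-size≤ : ∀ {g ps t} σ → isDef g ≡ true → fun g ps ▷* t →
                      ∃ λ i → safe g i ≡ false × size⟪ σ ⟫ t ≤ size⟪ σ ⟫ (lookup ps i)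
    ▷*-normal-size≤ σ d (sub i normal (inj₁ psᵢ▷t)) = i , normal d , <⇒≤ (▷*-size< σ psᵢ▷t)
    ▷*-normal-size≤ σ d (sub i normal (inj₂ psᵢ≈t)) = i , normal d , ≤-reflexive (sym (≈s-size σ psᵢ≈t))

    module _ (qp : IsQuasiPrecedence) (adm : Admissible) (sm : SafeMapping) where

      ≿-trans : ∀ {f g h} → f ≿ g → g ≿ h → f ≿ h
      ≿-trans = IsPreorder.trans (proj₁ qp)

      ≻-irrefl : ∀ {f} → ¬ f ≻ f
      ≻-irrefl (f≿f , f⋦f) = f⋦f f≿f

      ≿-≻-trans : ∀ {f g h} → f ≿ g → g ≻ h → f ≻ h
      ≿-≻-trans f≿g (g≿h , h⋦g) = ≿-trans f≿g g≿h , λ h≿f → h⋦g (≿-trans h≿f f≿g)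

      ≿-constructor : ∀ {c g} → isDef c ≡ false → c ≿ g → isDef g ≡ false
      ≿-constructor {c} {g} c∈𝒞 c≿g with isDef g in g∈?
      ... | true  = contradiction c≿g (proj₂ (adm g c g∈? c∈𝒞))
      ... | false = refl

      normArgs-constructor : ∀ {c} (ts : Vec Term (ar c)) → isDef c ≡ false → normArgs c ts ≡ []
      normArgs-constructor {c} ts c∈𝒞 = select-none (not ∘ safe c) ts (λ i → ≡.cong not (sm c i c∈𝒞))

      VAll-constructor : ∀ {P : Term → Set} {c} {ts : Vec Term (ar c)} → isDef c ≡ false →
                         All P (safeArgs c ts) → VAll.All P ts
      VAll-constructor {c = c} {ts} c∈𝒞 all =
        lookup⁻ (λ i → All-select⁻ (safe c) ts all i (sm c i c∈𝒞))

      All-select-VAll : ∀ {P : Term → Set} {n} (p : Fin n → Bool) {xs : Vec Term n} →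
                        VAll.All P xs → All P (select p xs)
      All-select-VAll p {xs} all = All-select⁺ p xs (λ i _ → lookup⁺ all i)

      mutual
        ConTerm-≈s : ∀ {s t} → ConTerm s → s ≈s t → ConTerm t
        ConTerm-≈s c ≈-refl = c
        ConTerm-≈s (fun c∈𝒞 cs) (≈-fun {f} f∼g _ safe≈) =
          fun g∈𝒞 (VAll-constructor g∈𝒞 (ConTerm-≈s* (All-select-VAll (safe f) cs) safe≈))
          where g∈𝒞 = ≿-constructor c∈𝒞 (proj₁ f∼g)

        ConTerm-≈s* : ∀ {xs ys} → All ConTerm xs → Pointwise _≈s_ xs ys → All ConTerm ys
        ConTerm-≈s* []       []            = []
        ConTerm-≈s* (c ∷ cs) (x≈y ∷ xs≈ys) = ConTerm-≈s c x≈y ∷ ConTerm-≈s* cs xs≈ys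

      ConTerm-▷* : ∀ {s t} → ConTerm s → s ▷* t → ConTerm t
      ConTerm-▷* (fun _ cs) (sub i _ (inj₁ sᵢ▷t)) = ConTerm-▷* (lookup⁺ cs i) sᵢ▷t
      ConTerm-▷* (fun _ cs) (sub i _ (inj₂ sᵢ≈t)) = ConTerm-≈s (lookup⁺ cs i) sᵢ≈t

      mutual
        ConTerm->epo : ∀ {s t} → ConTerm s → s >epo t → ConTerm t
        ConTerm->epo (fun _ cs) (epo1 i (inj₁ sᵢ>t)) = ConTerm->epo (lookup⁺ cs i) sᵢ>t
        ConTerm->epo (fun _ cs) (epo1 i (inj₂ sᵢ≈t)) = ConTerm-≈s (lookup⁺ cs i) sᵢ≈t
        ConTerm->epo c@(fun c∈𝒞 _) (epo2 f≻g _ s>safe) =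
          fun g∈𝒞 (VAll-constructor g∈𝒞 (ConTerm->epo* c s>safe))
          where g∈𝒞 = ≿-constructor c∈𝒞 (proj₁ f≻g)
        ConTerm->epo (fun {ts = ss} c∈𝒞 _) (epo3 _ ps rs _ _ a _ normal≡ _ _ _ _ _)
          with () ← ++-conicalʳ ps (a ∷ rs) (trans (sym normal≡) (normArgs-constructor ss c∈𝒞))

        ConTerm->epo* : ∀ {s xs} → ConTerm s → All (s >epo_) xs → All ConTerm xs
        ConTerm->epo* c []           = []
        ConTerm->epo* c (s>x ∷ s>xs) = ConTerm->epo c s>x ∷ ConTerm->epo* c s>xs

      Rank< : Fin N → ℕ → Set
      Rank< g zero    = ⊥
      Rank< g (suc h) = ∀ g′ → g ≻ g′ → Rank< g′ h

      Rank<-∼ : ∀ {f g} h → f ∼ g → Rank< f h → Rank< g h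
      Rank<-∼ (suc h) (f≿g , _) rank g′ g≻g′ = rank g′ (≿-≻-trans f≿g g≻g′)

      lookup-∷-injective : ∀ {k} (v : Vec (Fin N) k) g → (∀ i → lookup v i ≻ g) →
                           Injective _≡_ _≡_ (lookup v) → Injective _≡_ _≡_ (lookup (g ∷ v))
      lookup-∷-injective v g above inj {zero}  {zero}  e = refl
      lookup-∷-injective v g above inj {zero}  {suc j} e = ⊥-elim (≻-irrefl (subst (_≻ g) (sym e) (above j)))
      lookup-∷-injective v g above inj {suc i} {zero}  e = ⊥-elim (≻-irrefl (subst (_≻ g) e (above i)))
      lookup-∷-injective v g above inj {suc i} {suc j} e = ≡.cong suc (inj e)

      -- Pigeonhole: v followed by a ≻-chain descending from g lists pairwise distinct symbols.
      Rank<-below : ∀ h {k} (v : Vec (Fin N) k) g → (∀ i → lookup v i ≻ g) →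
                    Injective _≡_ _≡_ (lookup v) → N ≤ k + h → Rank< g h
      Rank<-below zero {k} v g above inj N≤k+0 =
        <-irrefl refl (≤-trans (injective⇒≤ (lookup-∷-injective v g above inj))
                               (subst (N ≤_) (+-identityʳ k) N≤k+0))
      Rank<-below (suc h) {k} v g above inj N≤k+1+h g′ g≻g′ =
        Rank<-below h (g ∷ v) g′ above′ (lookup-∷-injective v g above inj) (subst (N ≤_) (+-suc k h) N≤k+1+h)
        where
        above′ : ∀ i → lookup (g ∷ v) i ≻ g′
        above′ zero    = g≻g′
        above′ (suc i) = ≿-≻-trans (proj₁ (above i)) g≻g′

      Rank<-N : ∀ g → Rank< g N
      Rank<-N g = Rank<-below N [] g (λ ()) (λ {i} → ⊥-elim (¬Fin0 i)) ≤-refl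

      module _ (R : TRS) (ctrs : ConstructorTRS R) where

        lhs-basic : ∀ {ρ} → ρ ∈ R →
                    ∃₂ λ f ps → lhs ρ ≡ fun f ps × isDef f ≡ true × VAll.All ConTerm ps
        lhs-basic {ρ} ρ∈R with lhs ρ | ctrs ρ∈R
        ... | _ | basic f∈𝒟 cs = _ , _ , refl , f∈𝒟 , cs

        lhs⟪⟫-defined-root : ∀ {ρ} σ → ρ ∈ R → ∃₂ λ f ts → lhs ρ ⟪ σ ⟫ ≡ fun f ts × isDef f ≡ true
        lhs⟪⟫-defined-root σ ρ∈R with lhs-basic ρ∈R
        ... | _ , ps , lhs≡ , f∈𝒟 , _ = _ , substs ps σ , ≡.cong (_⟪ σ ⟫) lhs≡ , f∈𝒟

        var-irreducible : ∀ {t u x} → R ⊢ t ⟶ u → t ≢ var x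
        var-irreducible (root σ ρ∈R) t≡x with lhs⟪⟫-defined-root σ ρ∈R
        ... | _ , _ , t≡f[ts] , _ with () ← trans (sym t≡f[ts]) t≡x

        constructor-irreducible : ∀ {c ts t u} → isDef c ≡ false → (∀ i → NF R (lookup ts i)) →
                                  R ⊢ t ⟶ u → t ≢ fun c ts
        constructor-irreducible c∈𝒞 nf (root σ ρ∈R) t≡c[ts] with lhs⟪⟫-defined-root σ ρ∈R
        ... | _ , _ , t≡f[ts] , f∈𝒟 with trans (sym t≡f[ts]) t≡c[ts]
        ...   | refl with () ← trans (sym f∈𝒟) c∈𝒞
        constructor-irreducible c∈𝒞 nf (cong i tsᵢ⟶u) refl = nf i _ tsᵢ⟶u

        var-NF : ∀ {x} → NF R (var x)
        var-NF u x⟶u = var-irreducible x⟶u refl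

        constructor-NF : ∀ {c ts} → isDef c ≡ false → (∀ i → NF R (lookup ts i)) → NF R (fun c ts)
        constructor-NF c∈𝒞 nf u c[ts]⟶u = constructor-irreducible c∈𝒞 nf c[ts]⟶u refl

        mutual
          ConTerm⟪⟫-NF : ∀ {t σ} → ConTerm t → (∀ x → x ∈V t → NF R (σ x)) → NF R (t ⟪ σ ⟫)
          ConTerm⟪⟫-NF (var x)       nf = nf x here
          ConTerm⟪⟫-NF (fun c∈𝒞 cs) nf = constructor-NF c∈𝒞 (ConTerms⟪⟫-NF cs (λ x i → nf x ∘ arg i))

          ConTerms⟪⟫-NF : ∀ {n} {ts : Vec Term n} {σ} → VAll.All ConTerm ts →
                          (∀ x i → x ∈V lookup ts i → NF R (σ x)) → ∀ i → NF R (lookup (substs ts σ) i)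
          ConTerms⟪⟫-NF (c VAll.∷ cs) nf zero    = ConTerm⟪⟫-NF c (λ x → nf x zero)
          ConTerms⟪⟫-NF (c VAll.∷ cs) nf (suc i) = ConTerms⟪⟫-NF cs (λ x → nf x ∘ suc) i

        ConTerm-NF : ∀ {t} → ConTerm t → NF R t
        ConTerm-NF {t} c = subst (NF R) (⟪var⟫-identity t) (ConTerm⟪⟫-NF c (λ _ _ → var-NF))

        ⟶ᵢ⇒⟶ : ∀ {t u} → R ⊢ t ⟶ᵢ u → R ⊢ t ⟶ u
        ⟶ᵢ⇒⟶ (root σ ρ∈R _)  = root σ ρ∈R
        ⟶ᵢ⇒⟶ (cong i tᵢ⟶u) = cong i (⟶ᵢ⇒⟶ tᵢ⟶u)

        -- The indices of _⊢_⟶ᵢ_ are not patterns; this view lets a step from a term of known shape be matched.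
        data InnermostStep (t u : Term) : Set where
          at-root : ∀ {ρ} σ → ρ ∈ R → t ≡ lhs ρ ⟪ σ ⟫ → u ≡ rhs ρ ⟪ σ ⟫ →
                    (∀ v → v ◁ t → NF R v) → InnermostStep t u
          below   : ∀ {f ts u′} i → t ≡ fun f ts → u ≡ fun f (ts [ i ]≔ u′) →
                    R ⊢ lookup ts i ⟶ᵢ u′ → InnermostStep t u

        innermostStep : ∀ {t u} → R ⊢ t ⟶ᵢ u → InnermostStep t u
        innermostStep (root σ ρ∈R nf) = at-root σ ρ∈R refl refl nf
        innermostStep (cong i tᵢ⟶u)  = below i refl refl tᵢ⟶u

        record Dl≤ (t : Term) (b : ℕ) : Set where
          constructor dl≤
          field bound : ∀ {m u} → R ⊢ t ⟶ᵢ[ m ] u → m ≤ b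
        open Dl≤

        Dl≤-mono : ∀ {t a b} → a ≤ b → Dl≤ t a → Dl≤ t b
        Dl≤-mono a≤b dl = dl≤ λ t⟶ᵐu → ≤-trans (bound dl t⟶ᵐu) a≤b

        NF⇒Dl≤0 : ∀ {t} → NF R t → Dl≤ t 0
        NF⇒Dl≤0 nf = dl≤ λ { done → z≤n ; (step t⟶u _) → contradiction (⟶ᵢ⇒⟶ t⟶u) (nf _) }

        Dl≤-step : ∀ {t u b} → Dl≤ t b → R ⊢ t ⟶ᵢ u → ∃ λ b′ → b ≡ suc b′ × Dl≤ u b′
        Dl≤-step {b = zero}  dl t⟶u with () ← bound dl (step t⟶u done)
        Dl≤-step {b = suc b} dl t⟶u = b , refl , dl≤ λ u⟶ᵐv → s≤s⁻¹ (bound dl (step t⟶u u⟶ᵐv))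

        CallBound : ℕ → (f : Fin N) → Vec Term (ar f) → Set
        CallBound c f ts₀ = ∀ ts → (∀ i → NF R (lookup ts i)) → SameNormalArgs f ts ts₀ → Dl≤ (fun f ts) c

        constructor-CallBound : ∀ {b c ts₀} → isDef c ≡ false → CallBound b c ts₀
        constructor-CallBound c∈𝒞 ts nf _ = Dl≤-mono z≤n (NF⇒Dl≤0 (constructor-NF c∈𝒞 nf))

        -- Before the root step, which needs all arguments in normal form, only the safe arguments move.
        Dl≤-fun : ∀ {f ts₀ ts} (b : Vector ℕ (ar f)) {c} →
                  (∀ i → Dl≤ (lookup ts i) (b i)) →
                  (∀ i → safe f i ≡ false → NF R (lookup ts i)) →
                  SameNormalArgs f ts ts₀ → CallBound c f ts₀ → Dl≤ (fun f ts) (sum b + c)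
        Dl≤-fun {f} {ts₀} b {c} dl nf anchored cb = dl≤ (go b dl nf anchored)
          where
          go : ∀ {ts} b → (∀ i → Dl≤ (lookup ts i) (b i)) →
               (∀ i → safe f i ≡ false → NF R (lookup ts i)) →
               SameNormalArgs f ts ts₀ → ∀ {m u} → R ⊢ fun f ts ⟶ᵢ[ m ] u → m ≤ sum b + c
          go b dl nf anchored done = z≤n
          go {ts} b dl nf anchored (step s rest) with innermostStep s
          ... | at-root _ _ _ _ nf′ =
            ≤-trans (bound (cb ts (λ i → nf′ _ (direct i refl)) anchored) (step s rest)) (m≤n+m c (sum b))
          ... | below {u′ = u′} i refl refl tsᵢ⟶u′ with safe f i in safeᵢ
          ...   | false = contradiction (⟶ᵢ⇒⟶ tsᵢ⟶u′) (nf i safeᵢ _)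
          ...   | true with Dl≤-step (dl i) tsᵢ⟶u′
          ...     | v , bᵢ≡1+v , dl′ =
            subst (λ z → _ ≤ z + c) (sym (sum-updateAt-pred b i bᵢ≡1+v))
                  (s≤s (go (updateAt b i (const v)) dl₁ nf₁ anchored₁ rest))
            where
            ts₁ = ts [ i ]≔ u′
            normal-untouched : ∀ j → safe f j ≡ false → lookup ts₁ j ≡ lookup ts j
            normal-untouched j safeⱼ = lookup∘update′ j≢i ts u′
              where j≢i : j ≢ i
                    j≢i refl with () ← trans (sym safeᵢ) safeⱼ
            dl₁ : ∀ j → Dl≤ (lookup ts₁ j) (updateAt b i (const v) j)
            dl₁ j with j Fin.≟ i
            ... | yes refl = subst₂ Dl≤ (sym (lookup∘update i ts u′)) (sym (updateAt-updates i b)) dl′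
            ... | no j≢i   =
              subst₂ Dl≤ (sym (lookup∘update′ j≢i ts u′)) (sym (updateAt-minimal j i b j≢i)) (dl j)
            nf₁ : ∀ j → safe f j ≡ false → NF R (lookup ts₁ j)
            nf₁ j safeⱼ = subst (NF R) (sym (normal-untouched j safeⱼ)) (nf j safeⱼ)
            anchored₁ : SameNormalArgs f ts₁ ts₀
            anchored₁ j safeⱼ = trans (normal-untouched j safeⱼ) (anchored j safeⱼ)

        data CallsBounded (q : ℕ) (σ : Subst) : Term → Set where
          var : ∀ {x} → NF R (σ x) → CallsBounded q σ (var x)
          fun : ∀ {f ss} → (∀ i → CallsBounded q σ (lookup ss i)) →
                (∀ i → safe f i ≡ false → NF R (lookup ss i ⟪ σ ⟫)) →
                CallBound q f (substs ss σ) → CallsBounded q σ (fun f ss)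

        CallsBounded⇒Dl≤ : ∀ {q σ r} → CallsBounded q σ r → Dl≤ (r ⟪ σ ⟫) (size r * q)
        CallsBounded⇒Dl≤ (var nf) = Dl≤-mono z≤n (NF⇒Dl≤0 nf)
        CallsBounded⇒Dl≤ {q} {σ} (fun {f} {ss} args normal cb) =
          subst (Dl≤ _) (trans (≡.cong (_+ q) (sum-size*≡sizes* ss q)) (+-comm (sizes ss * q) q))
            (Dl≤-fun {ts₀ = substs ss σ} (λ i → size (lookup ss i) * q)
               (λ i → subst (λ t → Dl≤ t _) (sym (lookup-substs ss σ i)) (CallsBounded⇒Dl≤ (args i)))
               (λ i safeᵢ → subst (NF R) (sym (lookup-substs ss σ i)) (normal i safeᵢ))
               (λ _ _ → refl) cb)

        mutual
          ConTerm-CallsBounded : ∀ {q σ t} → ConTerm t → (∀ x → x ∈V t → NF R (σ x)) → CallsBounded q σ t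
          ConTerm-CallsBounded (var x)       nf = var (nf x here)
          ConTerm-CallsBounded {σ = σ} (fun {ts = ss} c∈𝒞 cs) nf =
            fun (ConTerms-CallsBounded cs (λ x i x∈ → nf x (arg i x∈)))
                (λ i _ → ConTerm⟪⟫-NF (lookup⁺ cs i) (λ x x∈ → nf x (arg i x∈)))
                (constructor-CallBound {ts₀ = substs ss σ} c∈𝒞)

          ConTerms-CallsBounded : ∀ {q σ n} {ts : Vec Term n} → VAll.All ConTerm ts →
                                  (∀ x i → x ∈V lookup ts i → NF R (σ x)) → ∀ i → CallsBounded q σ (lookup ts i)
          ConTerms-CallsBounded (c VAll.∷ cs) nf zero    = ConTerm-CallsBounded c (λ x → nf x zero)
          ConTerms-CallsBounded (c VAll.∷ cs) nf (suc i) = ConTerms-CallsBounded cs (λ x → nf x ∘ suc) i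

        module _ (comp : Compatible R) (n A K : ℕ) (ar≤A : ∀ f → ar f ≤ A)
                 (rhs≤K : ∀ {ρ} → ρ ∈ R → size (rhs ρ) ≤ K) where

          M : ℕ
          M = suc n ^ A

          -- Sizes ≤ n are digits in base n + 1, so codes compare normal arguments lexicographically.
          code : (g : Fin N) → Vec Term (ar g) → ℕ
          code g ts = numeral (suc n) A (List.map size (normArgs g ts))

          NormalSizes≤n : (g : Fin N) → Vec Term (ar g) → Set
          NormalSizes≤n g ts = ∀ i → safe g i ≡ false → size (lookup ts i) ≤ n

          length-normal-sizes≤A : ∀ {g} (ts : Vec Term (ar g)) → length (List.map size (normArgs g ts)) ≤ A
          length-normal-sizes≤A {g} ts = begin
            length (List.map size (normArgs g ts))  ≡⟨ length-map size (normArgs g ts) ⟩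
            length (normArgs g ts)                  ≤⟨ length-select≤ (not ∘ safe g) ts ⟩
            ar g                                    ≤⟨ ar≤A g ⟩
            A                                       ∎
            where open ≤-Reasoning

          code<M : ∀ {g} (ts : Vec Term (ar g)) → NormalSizes≤n g ts → code g ts < M
          code<M {g} ts small = numeral< (suc n) A _ digits<base (length-normal-sizes≤A ts)
            where
            digits<base : All (_< suc n) (List.map size (normArgs g ts))
            digits<base = map⁺ (All-select⁺ (not ∘ safe g) ts (λ i → s≤s ∘ small i ∘ not≡true))

          normal-sizes-substs : ∀ {f} (ts ts′ : Vec Term (ar f)) σ → SameNormalArgs f ts′ (substs ts σ) →
                                List.map size (normArgs f ts′) ≡ List.map size⟪ σ ⟫ (normArgs f ts)
          normal-sizes-substs {f} ts ts′ σ same = begin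
            List.map size (normArgs f ts′)
              ≡⟨ ≡.cong (List.map size)
                        (select-cong (not ∘ safe f) ts′ (substs ts σ) (λ i → same i ∘ not≡true)) ⟩
            List.map size (normArgs f (substs ts σ))
              ≡⟨ ≡.cong (List.map size) (select-substs (not ∘ safe f) ts σ) ⟩
            List.map size (List.map (_⟪ σ ⟫) (normArgs f ts))
              ≡⟨ map-∘ (normArgs f ts) ⟨
            List.map size⟪ σ ⟫ (normArgs f ts)   ∎
            where open ≡-Reasoning

          code-lex-< : ∀ {f g} {ss : Vec Term (ar f)} {ts ts′ : Vec Term (ar g)} σ {ps rs qs rt a b} →
                       normArgs f ss ≡ ps ++ a ∷ rs → normArgs g ts ≡ qs ++ b ∷ rt →
                       Pointwise _≈s_ ps qs → size⟪ σ ⟫ b < size⟪ σ ⟫ a → All (λ t → size⟪ σ ⟫ t ≤ n) rt →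
                       SameNormalArgs g ts′ (substs ts σ) → code g ts′ < code f (substs ss σ)
          code-lex-< {f} {g} {ss} {ts} {ts′} σ {ps} {rs} {qs} {rt} {a} {b} ss≡ ts≡ ps≈qs b<a rt≤n same =
            subst₂ _<_ (≡.cong (numeral (suc n) A) (sym ts′-sizes)) (≡.cong (numeral (suc n) A) (sym ss-sizes))
              (numeral-lex-< (suc n) A sizes⟪ ps ⟫ sizes⟪ rs ⟫ sizes⟪ rt ⟫ b<a (map⁺ (All.map s≤s rt≤n))
                 (subst (λ xs → length xs ≤ A) ts′-sizes (length-normal-sizes≤A ts′)))
            where
            open ≡-Reasoning
            sizes⟪_⟫ : List Term → List ℕ
            sizes⟪ xs ⟫ = List.map size⟪ σ ⟫ xs
            ts′-sizes : List.map size (normArgs g ts′) ≡ sizes⟪ ps ⟫ ++ size⟪ σ ⟫ b ∷ sizes⟪ rt ⟫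
            ts′-sizes = begin
              List.map size (normArgs g ts′)        ≡⟨ normal-sizes-substs ts ts′ σ same ⟩
              sizes⟪ normArgs g ts ⟫                ≡⟨ ≡.cong sizes⟪_⟫ ts≡ ⟩
              sizes⟪ qs ++ b ∷ rt ⟫                 ≡⟨ map-++ size⟪ σ ⟫ qs (b ∷ rt) ⟩
              sizes⟪ qs ⟫ ++ size⟪ σ ⟫ b ∷ sizes⟪ rt ⟫
                ≡⟨ ≡.cong (_++ size⟪ σ ⟫ b ∷ sizes⟪ rt ⟫) (≈s-sizes σ ps≈qs) ⟨
              sizes⟪ ps ⟫ ++ size⟪ σ ⟫ b ∷ sizes⟪ rt ⟫ ∎
            ss-sizes : List.map size (normArgs f (substs ss σ)) ≡ sizes⟪ ps ⟫ ++ size⟪ σ ⟫ a ∷ sizes⟪ rs ⟫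
            ss-sizes = begin
              List.map size (normArgs f (substs ss σ)) ≡⟨ normal-sizes-substs ss (substs ss σ) σ (λ _ _ → refl) ⟩
              sizes⟪ normArgs f ss ⟫                  ≡⟨ ≡.cong sizes⟪_⟫ ss≡ ⟩
              sizes⟪ ps ++ a ∷ rs ⟫                   ≡⟨ map-++ size⟪ σ ⟫ ps (a ∷ rs) ⟩
              sizes⟪ ps ⟫ ++ size⟪ σ ⟫ a ∷ sizes⟪ rs ⟫ ∎

          -- The index h * M + code g ts drops from a call to the calls of the right-hand side rewriting
          -- it: h for ≻ (epo2), the code for ∼ (epo3).
          CallsWithin : ℕ → Set
          CallsWithin j = ∀ {g ts} h → Rank< g h → h * M + code g ts ≤ j → NormalSizes≤n g ts →
                          (∀ i → NF R (lookup ts i)) → Dl≤ (fun g ts) (suc K ^ j)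

          module RhsCalls (j : ℕ) (ih : CallsWithin j) {g ps} (σ : Subst) (g∈𝒟 : isDef g ≡ true)
                          (cps : VAll.All ConTerm ps) (h : ℕ) (rank : Rank< g (suc h))
                          (index≤ : suc h * M + code g (substs ps σ) ≤ suc j)
                          (small : ∀ i → safe g i ≡ false → size⟪ σ ⟫ (lookup ps i) ≤ n) where

            q : ℕ
            q = suc K ^ j

            ▷*-small : ∀ {t} → fun g ps ▷* t → size⟪ σ ⟫ t ≤ n
            ▷*-small ▷t with ▷*-normal-size≤ σ g∈𝒟 ▷t
            ... | i , safeᵢ , t≤psᵢ = ≤-trans t≤psᵢ (small i safeᵢ)

            ▷*-ConTerm : ∀ {t} → fun g ps ▷* t → ConTerm t
            ▷*-ConTerm (sub i _ (inj₁ psᵢ▷t)) = ConTerm-▷* (lookup⁺ cps i) psᵢ▷t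
            ▷*-ConTerm (sub i _ (inj₂ psᵢ≈t)) = ConTerm-≈s (lookup⁺ cps i) psᵢ≈t

            NormalVars : Term → Set
            NormalVars r = ∀ x → x ∈V r → NF R (σ x)

            call-small : ∀ {f} {ts ts′ : Vec Term (ar f)} → All (fun g ps ▷*_) (normArgs f ts) →
                         SameNormalArgs f ts′ (substs ts σ) → NormalSizes≤n f ts′
            call-small {f} {ts} ▷normal same i safeᵢ =
              subst (_≤ n) (≡.cong size (sym (trans (same i safeᵢ) (lookup-substs ts σ i))))
                (▷*-small (All-select⁻ (not ∘ safe f) ts ▷normal i (≡.cong not safeᵢ)))

            fun-CallsBounded : ∀ {f} (ts : Vec Term (ar f)) → All (fun g ps ▷*_) (normArgs f ts) →
                               All (λ r → NormalVars r → CallsBounded q σ r) (safeArgs f ts) →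
                               CallBound q f (substs ts σ) → NormalVars (fun f ts) → CallsBounded q σ (fun f ts)
            fun-CallsBounded {f} ts ▷normal safe-ok cb vars = fun args normal cb
              where
              normal-ConTerm : ∀ i → safe f i ≡ false → ConTerm (lookup ts i)
              normal-ConTerm i safeᵢ = ▷*-ConTerm (All-select⁻ (not ∘ safe f) ts ▷normal i (≡.cong not safeᵢ))
              args : ∀ i → CallsBounded q σ (lookup ts i)
              args i with safe f i in safeᵢ
              ... | true  = All-select⁻ (safe f) ts safe-ok i safeᵢ (λ x → vars x ∘ arg i)
              ... | false = ConTerm-CallsBounded (normal-ConTerm i safeᵢ) (λ x → vars x ∘ arg i)
              normal : ∀ i → safe f i ≡ false → NF R (lookup ts i ⟪ σ ⟫)
              normal i safeᵢ = ConTerm⟪⟫-NF (normal-ConTerm i safeᵢ) (λ x → vars x ∘ arg i)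

            lower-rank-index≤ : ∀ c → c < M → h * M + c ≤ j
            lower-rank-index≤ c c<M = s≤s⁻¹ (begin-strict
              h * M + c                         <⟨ +-monoʳ-< (h * M) c<M ⟩
              h * M + M                         ≡⟨ +-comm (h * M) M ⟩
              suc h * M                         ≤⟨ m≤m+n (suc h * M) _ ⟩
              suc h * M + code g (substs ps σ)  ≤⟨ index≤ ⟩
              suc j                             ∎)
              where open ≤-Reasoning

            lower-code-index≤ : ∀ c → c < code g (substs ps σ) → suc h * M + c ≤ j
            lower-code-index≤ c c<code = s≤s⁻¹ (≤-trans (+-monoʳ-< (suc h * M) c<code) index≤)

            CallBound-≻ : ∀ {f} (ts : Vec Term (ar f)) → g ≻ f → All (fun g ps ▷*_) (normArgs f ts) →
                          CallBound q f (substs ts σ)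
            CallBound-≻ ts g≻f ▷normal ts′ nf same =
              ih {ts = ts′} h (rank _ g≻f) (lower-rank-index≤ _ (code<M ts′ small′)) small′ nf
              where small′ = call-small {ts = ts} {ts′} ▷normal same

            CallBound-∼ : ∀ {f} (ts : Vec Term (ar f)) → g ∼ f → All (fun g ps ▷*_) (normArgs f ts) →
                          (∀ ts′ → SameNormalArgs f ts′ (substs ts σ) → code f ts′ < code g (substs ps σ)) →
                          CallBound q f (substs ts σ)
            CallBound-∼ ts g∼f ▷normal code< ts′ nf same =
              ih {ts = ts′} (suc h) (Rank<-∼ (suc h) g∼f rank) (lower-code-index≤ _ (code< ts′ same))
                 (call-small {ts = ts} {ts′} ▷normal same) nf

            Below : Term → Set
            Below e = ∀ {t} → e ▷* t ⊎ e ≈s t → fun g ps ▷* t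

            normal-Below : All Below (normArgs g ps)
            normal-Below = All-select⁺ (not ∘ safe g) ps (λ i normalᵢ → sub i (λ _ → not≡true normalᵢ))

            ≈s-Below : ∀ {xs ys} → All Below xs → Pointwise _≈s_ xs ys → All (fun g ps ▷*_) ys
            ≈s-Below []                  []            = []
            ≈s-Below (x-below ∷ xs-below) (x≈y ∷ xs≈ys) = x-below (inj₂ x≈y) ∷ ≈s-Below xs-below xs≈ys

            mutual
              rhs-CallsBounded : ∀ {r} → fun g ps >epo r → NormalVars r → CallsBounded q σ r
              rhs-CallsBounded (epo1 i (inj₁ psᵢ>r)) = ConTerm-CallsBounded (ConTerm->epo (lookup⁺ cps i) psᵢ>r)
              rhs-CallsBounded (epo1 i (inj₂ psᵢ≈r)) = ConTerm-CallsBounded (ConTerm-≈s (lookup⁺ cps i) psᵢ≈r)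
              rhs-CallsBounded (epo2 {ts = ts} g≻f ▷normal >safe) =
                fun-CallsBounded ts ▷normal (rhs-CallsBounded* >safe) (CallBound-≻ ts g≻f ▷normal)
              rhs-CallsBounded (epo3 {g = f} {ts} g∼f ps′ rs qs rt a b ps≡ ts≡ ps′≈qs a▷b ▷rt >safe) =
                fun-CallsBounded ts ▷normal (rhs-CallsBounded* >safe) (CallBound-∼ ts g∼f ▷normal code<)
                where
                ▷normal : All (fun g ps ▷*_) (normArgs f ts)
                ▷normal with ++⁻ ps′ (subst (All Below) ps≡ normal-Below)
                ... | below-ps′ , below-a ∷ _ =
                  subst (All _) (sym ts≡) (++⁺ (≈s-Below below-ps′ ps′≈qs) (below-a (inj₁ a▷b) ∷ ▷rt))
                code< : ∀ ts′ → SameNormalArgs f ts′ (substs ts σ) → code f ts′ < code g (substs ps σ)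
                code< ts′ = code-lex-< {g} {f} {ps} {ts} {ts′} σ ps≡ ts≡ ps′≈qs
                                       (▷*-size< σ a▷b) (All.map ▷*-small ▷rt)

              rhs-CallsBounded* : ∀ {xs} → All (fun g ps >epo_) xs →
                                  All (λ r → NormalVars r → CallsBounded q σ r) xs
              rhs-CallsBounded* []           = []
              rhs-CallsBounded* (>x ∷ >xs) = rhs-CallsBounded >x ∷ rhs-CallsBounded* >xs

          rhs-Dl≤ : ∀ j → CallsWithin j → ∀ {g ts ρ σ} h → Rank< g (suc h) → suc h * M + code g ts ≤ suc j →
                    NormalSizes≤n g ts → ρ ∈ R → fun g ts ≡ lhs ρ ⟪ σ ⟫ → (∀ v → v ◁ fun g ts → NF R v) →
                    Dl≤ (rhs ρ ⟪ σ ⟫) (K * suc K ^ j)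
          rhs-Dl≤ j ih {ρ = ρ} {σ} h rank index≤ small ρ∈R g[ts]≡lσ nf with lhs-basic ρ∈R
          ... | f , ps , lhs≡ , f∈𝒟 , cps with trans g[ts]≡lσ (≡.cong (_⟪ σ ⟫) lhs≡)
          ... | refl = Dl≤-mono (*-monoˡ-≤ q (rhs≤K ρ∈R))
                         (CallsBounded⇒Dl≤ (rhs-CallsBounded (subst (_>epo rhs ρ) lhs≡ (comp ρ∈R)) vars))
            where
            open RhsCalls j ih σ f∈𝒟 cps h rank index≤
                          (λ i safeᵢ → subst (_≤ n) (≡.cong size (lookup-substs ps σ i)) (small i safeᵢ))
            vars : NormalVars (rhs ρ)
            vars x x∈r with ∈V-⟪⟫ (fun f ps) σ (subst (x ∈V_) lhs≡ (var-cond ρ x x∈r))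
            ... | inj₂ σx◁lσ = nf _ σx◁lσ

          0<index : ∀ h c → 0 < suc h * M + c
          0<index h c = ≤-trans (m^n>0 (suc n) A) (≤-trans (m≤m+n M (h * M)) (m≤m+n (suc h * M) c))

          callsWithin : ∀ j → CallsWithin j
          callsWithin j       zero    () _ _ _
          callsWithin zero    (suc h) _ index≤ _ _ = contradiction index≤ (<⇒≱ (0<index h _))
          callsWithin (suc j) {g} {ts} (suc h) rank index≤ small nf = dl≤ dl
            where
            dl : ∀ {m u} → R ⊢ fun g ts ⟶ᵢ[ m ] u → m ≤ suc K ^ suc j
            dl done = z≤n
            dl (step s rest) with innermostStep s
            ... | below i refl refl tsᵢ⟶u = contradiction (⟶ᵢ⇒⟶ tsᵢ⟶u) (nf i _)
            ... | at-root σ ρ∈R g[ts]≡lσ refl nf′ =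
              ≤-trans (s≤s (bound (rhs-Dl≤ j (callsWithin j) h rank index≤ small ρ∈R g[ts]≡lσ nf′) rest))
                      (+-monoˡ-≤ (K * suc K ^ j) (m^n>0 (suc K) j))

          basic-dl≤ : ∀ {t u m} → Basic t → size t ≤ n → R ⊢ t ⟶ᵢ[ m ] u → m ≤ suc K ^ (suc N * M)
          basic-dl≤ (basic {ts = ts} _ cs) t≤n =
            bound (callsWithin (suc N * M) N (Rank<-N _) index≤ small (λ i → ConTerm-NF (lookup⁺ cs i)))
            where
            small : NormalSizes≤n _ ts
            small i _ = ≤-trans (m≤n⇒m≤1+n (size-lookup≤sizes ts i)) t≤n
            index≤ : N * M + code _ ts ≤ suc N * M
            index≤ = ≤-trans (+-monoʳ-≤ (N * M) (<⇒≤ (code<M ts small))) (≤-reflexive (+-comm (N * M) M))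

theorem2 : (N : ℕ) (ar : Fin N → ℕ) (isDef : Fin N → Bool)
           (_≿_ : Rel (Fin N) 0ℓ) (safe : (f : Fin N) → Fin (ar f) → Bool) →
           let open Theory N ar isDef in
           let open Order _≿_ safe in
           IsQuasiPrecedence → Admissible → SafeMapping →
           (R : TRS) → ConstructorTRS R → Compatible R →
           ∃ λ (k : ℕ) → ∃ λ (c : ℕ) →
             ∀ (n : ℕ) (t u : Term) (m : ℕ) →
             Basic t → size t ≤ n → R ⊢ t ⟶ᵢ[ m ] u →
             m ≤ 2 ^ (c * n ^ k + c)
theorem2 N ar isDef _≿_ safe qp adm sm R ctrs comp = A , C , rc≤
  where
  open Theory N ar isDef
  A K C : ℕ
  A = max 0 (List.map ar (List.allFin N))
  K = max 0 (List.map (size ∘ rhs) R)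
  C = K * suc N * 2 ^ A
  rc≤ : ∀ n t u m → Basic t → size t ≤ n → R ⊢ t ⟶ᵢ[ m ] u → m ≤ 2 ^ (C * n ^ A + C)
  rc≤ n t u m t-basic t≤n t⟶ᵐu = ≤-trans
    (basic-dl≤ N ar isDef _≿_ safe qp adm sm R ctrs comp n A K
       (λ f → ≤-max-map ar (∈-allFin f)) (≤-max-map (size ∘ rhs)) t-basic t≤n t⟶ᵐu)
    (exponential-bound K N A n (≤-trans (0<size N ar isDef t) t≤n))
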